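{- Let $b\ge c\ge1$ be integers with $bc>4$, and let $(\alpha(k)),(\beta(k)),(\gamma(k))$, $r_k$ and $\delta(b,c)$ be as in the context. Then $\alpha(k)<\beta(k)$ for every integer $k\ge0$, and for every integer $k$: $2\alpha(k-2)+\alpha(k)=\beta(k-2)$; $\alpha(k-1)+r_k\alpha(k)=\beta(k-1)$; $2r_k\alpha(k)-\alpha(k-1)=\gamma(k+1)$; $\alpha(k)+r_k\alpha(k-1)=\gamma(k)$; and $\alpha(k-1)\beta(k)-\alpha(k)\beta(k-1)=\alpha(k)\gamma(k-1)-\alpha(k-1)\gamma(k)=r_{k-1}\alpha(k-1)\alpha(k+1)-r_k\alpha(k)^2=bc\,\alpha(k-1)\alpha(k)-r_{k-1}\alpha(k-1)^2-r_k\alpha(k)^2=\delta(b,c)>0$.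
   Context: For $k\in\mathbb{Z}$ let $r_k=b$ if $k$ is odd and $r_k=c$ if $k$ is even. Given initial values $a(0),a(-1)$, a sequence $(a(k))_{k\in\mathbb{Z}}$ is determined by $a(k)=r_{k-1}a(k-1)-a(k-2)$ for all $k\in\mathbb{Z}$ (used forward for $k>0$ and solved for $a(k-2)$ backward). The sequences $\alpha,\beta,\gamma$ are defined this way with initial data $(\alpha(0),\alpha(-1))$, $(\beta(0),\beta(-1))$, $(\gamma(0),\gamma(-1))$ equal to: if $\min(b,c)>1$: $(1,1)$, $((c-1)b+1,c+1)$, $(b+1,(b-1)c+1)$; if $c=1$: $(2,1)$, $(b+2,3)$, $(b+2,b-1)$. Finally $\delta(b,c)=bc-b-c$ if $\min(b,c)>1$ and $\delta(b,c)=b-4$ if $c=1$. -}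

module Defs where

open import Data.Bool using (Bool; true; false; not; if_then_else_)
open import Data.Nat using (ℕ; zero; suc)
open import Data.Integer using (ℤ; +_; -[1+_]; _+_; _-_; _*_)
open import Data.Product using (_×_; _,_; proj₁; proj₂)

natOdd : ℕ → Bool
natOdd zero    = false
natOdd (suc n) = not (natOdd n)

intOdd : ℤ → Bool
intOdd (+ n)     = natOdd n
intOdd -[1+ n ]  = not (natOdd n)

r : ℕ → ℕ → ℤ → ℤ
r b c k = if intOdd k then + b else + c

-- the two-sided sequence a with a(k) = r_{k-1} a(k-1) - a(k-2) for all k ∈ ℤ,
-- given a(0) = x0 and a(-1) = xm1.
module _ (b c : ℕ) (x0 xm1 : ℤ) where
  -- fwd n = (a(n-1), a(n))
  fwd : ℕ → ℤ × ℤ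
  fwd zero = xm1 , x0
  fwd (suc n) with fwd n
  ... | p , q = q , (r b c (+ n) * q - p)

  -- bwd m = (a(-m-1), a(-m))
  bwd : ℕ → ℤ × ℤ
  bwd zero = xm1 , x0
  bwd (suc m) with bwd m
  ... | p , q = (r b c -[1+ m ] * p - q) , p

  seq : ℤ → ℤ
  seq (+ n)      = proj₂ (fwd n)
  seq -[1+ m ]   = proj₁ (bwd m)

-- initial data (a(0), a(-1)); the case c = 1 vs min(b,c) = c > 1 (under b ≥ c ≥ 1)
α₀ : ℕ → ℕ → ℤ × ℤ
α₀ b (suc zero) = + 2 , + 1
α₀ b c          = + 1 , + 1

β₀ : ℕ → ℕ → ℤ × ℤ
β₀ b (suc zero) = + b + + 2 , + 3
β₀ b c          = (+ c - + 1) * + b + + 1 , + c + + 1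

γ₀ : ℕ → ℕ → ℤ × ℤ
γ₀ b (suc zero) = + b + + 2 , + b - + 1
γ₀ b c          = + b + + 1 , (+ b - + 1) * + c + + 1

α β γ : ℕ → ℕ → ℤ → ℤ
α b c = seq b c (proj₁ (α₀ b c)) (proj₂ (α₀ b c))
β b c = seq b c (proj₁ (β₀ b c)) (proj₂ (β₀ b c))
γ b c = seq b c (proj₁ (γ₀ b c)) (proj₂ (γ₀ b c))

δ : ℕ → ℕ → ℤ
δ b (suc zero) = + b - + 4
δ b c          = + b * + c - + b - + c

-- α, β and γ solve the same two-sided recurrence a(k+1) = r_k a(k) - a(k-1), whose
-- coefficient r is 2-periodic.  A solution is determined by two consecutive values, so
-- comparing initial data gives β(k) = α(k) + r_{k+1} α(k+1) and γ(k) = α(k) + r_{k-1} α(k-1),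
-- from which the four linear identities follow.  The Casoratian of two solutions is constant;
-- for α and β it is the quadratic form  bc α(k-1) α(k) - r_{k-1} α(k-1)² - r_k α(k)², so every
-- bilinear expression of the statement equals its value δ at k = 0.  If α(k-1) > 0 and
-- α(k) ≤ 0, each term of that form is ≤ 0, contradicting δ > 0; hence α > 0 on k ≥ 0 and
-- β(k) - α(k) = r_{k+1} α(k+1) > 0.

module Submission where

open import Defs
open import Data.Nat using (ℕ; _≤_) renaming (_<_ to _<ℕ_; _*_ to _*ℕ_)
open import Data.Integer using (ℤ; +_; _+_; _-_; _*_; _<_)
open import Data.Product using (_×_)
open import Relation.Binary.PropositionalEquality using (_≡_)

open import Data.Bool using (true; false; not; if_then_else_)
open import Data.Bool.Properties using (not-involutive)
open import Data.Nat using (zero; suc; s≤s; z≤n) renaming (_+_ to _+ℕ_)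
import Data.Nat.Properties as ℕ
open import Data.Integer using (-[1+_]; -_; +≤+; +<+) renaming (_≤_ to _≤ℤ_)
import Data.Integer.Properties as ℤ
open import Data.Integer.Tactic.RingSolver using (solve-∀; solve)
open import Data.List using (_∷_; [])
open import Data.Product using (_,_; proj₂)
open import Relation.Binary.PropositionalEquality using (refl; sym; trans; cong; cong₂; subst; module ≡-Reasoning)
open import Function using (_∘_)

i+1-1≡i : ∀ i → i + + 1 - + 1 ≡ i
i+1-1≡i = solve-∀

i-1+1≡i : ∀ i → i - + 1 + + 1 ≡ i
i-1+1≡i = solve-∀

i-2≡i-1-1 : ∀ i → i - + 2 ≡ i - + 1 - + 1
i-2≡i-1-1 = solve-∀

a-[a-x]≡x : ∀ a x → a - (a - x) ≡ x
a-[a-x]≡x = solve-∀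

ℤ-induction : (P : ℤ → Set) → P (+ 0) → (∀ i → P i → P (i + + 1)) → (∀ i → P (i + + 1) → P i) →
              ∀ i → P i
ℤ-induction P p₀ up down (+ zero)     = p₀
ℤ-induction P p₀ up down (+ suc n)    =
  subst P (cong +_ (ℕ.+-comm n 1)) (up (+ n) (ℤ-induction P p₀ up down (+ n)))
ℤ-induction P p₀ up down -[1+ zero ]  = down -[1+ zero ] p₀
ℤ-induction P p₀ up down -[1+ suc m ] = down -[1+ suc m ] (ℤ-induction P p₀ up down -[1+ m ])

step-invariant⇒constant : ∀ {A : Set} (F : ℤ → A) → (∀ i → F (i + + 1) ≡ F i) → ∀ i → F i ≡ F (+ 0)
step-invariant⇒constant F step = ℤ-induction (λ i → F i ≡ F (+ 0)) refl
  (λ i eq → trans (step i) eq) (λ i eq → trans (sym (step i)) eq)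

0≤*0≤ : ∀ {i j} → + 0 ≤ℤ i → + 0 ≤ℤ j → + 0 ≤ℤ i * j
0≤*0≤ {+ m} {+ n} (+≤+ _) (+≤+ _) = subst (+ 0 ≤ℤ_) (ℤ.pos-* m n) (+≤+ z≤n)

0<*0< : ∀ {i j} → + 0 < i → + 0 < j → + 0 < i * j
0<*0< (+<+ (s≤s _)) (+<+ (s≤s _)) = +<+ (s≤s z≤n)

quadratic≤0 : ∀ {B p q y z} → + 0 ≤ℤ B → + 0 ≤ℤ p → + 0 ≤ℤ q → + 0 ≤ℤ y → z ≤ℤ + 0 →
              B * y * z - p * (y * y) - q * (z * z) ≤ℤ + 0
quadratic≤0 {B} {p} {q} {y} {z} 0≤B 0≤p 0≤q 0≤y z≤0 =
  subst (_≤ℤ + 0) (sym (negate-terms B p q y z)) (ℤ.neg-mono-≤ terms≥0)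
  where
  negate-terms : ∀ B p q y z → B * y * z - p * (y * y) - q * (z * z)
                             ≡ - (B * y * (- z) + p * (y * y) + q * ((- z) * (- z)))
  negate-terms = solve-∀
  0≤-z : + 0 ≤ℤ - z
  0≤-z = ℤ.neg-mono-≤ z≤0
  terms≥0 : + 0 ≤ℤ B * y * (- z) + p * (y * y) + q * ((- z) * (- z))
  terms≥0 = ℤ.+-mono-≤ (ℤ.+-mono-≤ (0≤*0≤ (0≤*0≤ 0≤B 0≤y) 0≤-z) (0≤*0≤ 0≤p (0≤*0≤ 0≤y 0≤y)))
                       (0≤*0≤ 0≤q (0≤*0≤ 0≤-z 0≤-z))

0<quadratic⇒0<z : ∀ {B p q y z} → + 0 ≤ℤ B → + 0 ≤ℤ p → + 0 ≤ℤ q → + 0 ≤ℤ y →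
                  + 0 < B * y * z - p * (y * y) - q * (z * z) → + 0 < z
0<quadratic⇒0<z 0≤B 0≤p 0≤q 0≤y 0<Q =
  ℤ.≰⇒> (λ z≤0 → ℤ.<⇒≱ 0<Q (quadratic≤0 0≤B 0≤p 0≤q 0≤y z≤0))

natOdd-+1 : ∀ n → natOdd (n +ℕ 1) ≡ not (natOdd n)
natOdd-+1 zero    = refl
natOdd-+1 (suc n) = cong not (natOdd-+1 n)

intOdd-+1 : ∀ i → intOdd (i + + 1) ≡ not (intOdd i)
intOdd-+1 (+ n)          = natOdd-+1 n
intOdd-+1 -[1+ zero ]    = refl
intOdd-+1 -[1+ suc m ]   = sym (not-involutive (natOdd (suc m)))

intOdd--1 : ∀ i → intOdd (i - + 1) ≡ not (intOdd i)
intOdd--1 i = begin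
  intOdd (i - + 1)               ≡⟨ sym (not-involutive _) ⟩
  not (not (intOdd (i - + 1)))   ≡⟨ cong not (sym (intOdd-+1 (i - + 1))) ⟩
  not (intOdd (i - + 1 + + 1))   ≡⟨ cong (not ∘ intOdd) (i-1+1≡i i) ⟩
  not (intOdd i)                 ∎
  where open ≡-Reasoning

module LinearRecurrence (ρ : ℤ → ℤ) where

  Solution : (ℤ → ℤ) → Set
  Solution f = ∀ i → f (i + + 1) ≡ ρ i * f i - f (i - + 1)

  solution-backward : ∀ {f} → Solution f → ∀ i → f (i - + 1) ≡ ρ i * f i - f (i + + 1)
  solution-backward {f} f-sol i = trans (sym (a-[a-x]≡x (ρ i * f i) (f (i - + 1))))
                                        (cong (λ x → ρ i * f i - x) (sym (f-sol i)))

  solutions-equal : ∀ {f g} → Solution f → Solution g →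
                    f (+ 0) ≡ g (+ 0) → f -[1+ 0 ] ≡ g -[1+ 0 ] → ∀ i → f i ≡ g i
  solutions-equal {f} {g} f-sol g-sol eq₀ eq₋₁ i = proj₂ (ℤ-induction AgreeAt (eq₋₁ , eq₀) up down i)
    where
    AgreeAt : ℤ → Set
    AgreeAt i = (f (i - + 1) ≡ g (i - + 1)) × (f i ≡ g i)
    up : ∀ i → AgreeAt i → AgreeAt (i + + 1)
    up i (eq₋ , eq) =
        subst (λ j → f j ≡ g j) (sym (i+1-1≡i i)) eq
      , trans (f-sol i) (trans (cong₂ (λ u v → ρ i * u - v) eq eq₋) (sym (g-sol i)))
    down : ∀ i → AgreeAt (i + + 1) → AgreeAt i
    down i (eq , eq₊) =
        trans (solution-backward f-sol i)
              (trans (cong₂ (λ u v → ρ i * u - v) eq′ eq₊) (sym (solution-backward g-sol i)))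
      , eq′
      where
      eq′ : f i ≡ g i
      eq′ = subst (λ j → f j ≡ g j) (i+1-1≡i i) eq

  casoratian : (ℤ → ℤ) → (ℤ → ℤ) → ℤ → ℤ
  casoratian f g i = f (i - + 1) * g i - f i * g (i - + 1)

  casoratian-constant : ∀ {f g} → Solution f → Solution g →
                        ∀ i → casoratian f g i ≡ casoratian f g (+ 0)
  casoratian-constant {f} {g} f-sol g-sol = step-invariant⇒constant (casoratian f g) step
    where
    expand : ∀ x₋ x y₋ y p → x * (p * y - y₋) - (p * x - x₋) * y ≡ x₋ * y - x * y₋
    expand = solve-∀
    step : ∀ i → casoratian f g (i + + 1) ≡ casoratian f g i
    step i rewrite i+1-1≡i i | f-sol i | g-sol i =
      expand (f (i - + 1)) (f i) (g (i - + 1)) (g i) (ρ i)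

module _ (b c : ℕ) where
  open LinearRecurrence (r b c)

  r-+1≡r-1 : ∀ i → r b c (i + + 1) ≡ r b c (i - + 1)
  r-+1≡r-1 i = cong (λ odd → if odd then + b else + c) (trans (intOdd-+1 i) (sym (intOdd--1 i)))

  r-+2≡r : ∀ i → r b c (i + + 1 + + 1) ≡ r b c i
  r-+2≡r i = trans (r-+1≡r-1 (i + + 1)) (cong (r b c) (i+1-1≡i i))

  r--2≡r : ∀ i → r b c (i - + 1 - + 1) ≡ r b c i
  r--2≡r i = trans (sym (r-+1≡r-1 (i - + 1))) (cong (r b c) (i-1+1≡i i))

  r-1*r≡b*c : ∀ i → r b c (i - + 1) * r b c i ≡ + b * + c
  r-1*r≡b*c i = trans (cong (λ odd → (if odd then + b else + c) * r b c i) (intOdd--1 i))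
                      (alternate (intOdd i))
    where
    alternate : ∀ odd → (if not odd then + b else + c) * (if odd then + b else + c) ≡ + b * + c
    alternate true  = ℤ.*-comm (+ c) (+ b)
    alternate false = refl

  0≤r : ∀ i → + 0 ≤ℤ r b c i
  0≤r i with intOdd i
  ... | true  = +≤+ z≤n
  ... | false = +≤+ z≤n

  0<r : 1 ≤ b → 1 ≤ c → ∀ i → + 0 < r b c i
  0<r 1≤b 1≤c i with intOdd i
  ... | true  = +<+ 1≤b
  ... | false = +<+ 1≤c

  seq-solution : ∀ x₀ x₋₁ → Solution (seq b c x₀ x₋₁)
  seq-solution x₀ x₋₁ (+ zero)     = refl
  seq-solution x₀ x₋₁ (+ suc n)    = cong (seq b c x₀ x₋₁ ∘ +_) (ℕ.+-comm (suc n) 1)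
  seq-solution x₀ x₋₁ -[1+ zero ]  = sym (a-[a-x]≡x (r b c -[1+ zero ] * x₋₁) x₀)
  seq-solution x₀ x₋₁ -[1+ suc m ] =
    trans (sym (a-[a-x]≡x (r b c -[1+ suc m ] * a -[1+ suc m ]) (a -[1+ m ])))
          (cong (λ n → r b c -[1+ suc m ] * a -[1+ suc m ] - a -[1+ suc n ])
                (sym (ℕ.+-identityʳ (suc m))))
    where
    a : ℤ → ℤ
    a = seq b c x₀ x₋₁

  forwardSum backwardSum : (ℤ → ℤ) → ℤ → ℤ
  forwardSum  f i = f i + r b c (i + + 1) * f (i + + 1)
  backwardSum f i = f i + r b c (i - + 1) * f (i - + 1)

  quadraticForm : (ℤ → ℤ) → ℤ → ℤ
  quadraticForm f i = + b * + c * f (i - + 1) * f i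
                    - r b c (i - + 1) * (f (i - + 1) * f (i - + 1)) - r b c i * (f i * f i)

  forwardSum-at-pred : ∀ f i → f (i - + 1) + r b c i * f i ≡ forwardSum f (i - + 1)
  forwardSum-at-pred f i = cong (λ j → f (i - + 1) + r b c j * f j) (sym (i-1+1≡i i))

  module _ {f : ℤ → ℤ} (f-sol : Solution f) where

    forwardSum-solution : Solution (forwardSum f)
    forwardSum-solution i
      rewrite r-+2≡r i | f-sol (i + + 1) | i+1-1≡i i | i-1+1≡i i | solution-backward f-sol i =
        expand (f i) (f (i + + 1)) (r b c i) (r b c (i + + 1))
      where
      expand : ∀ x x₊ p p₊ → x₊ + p * (p₊ * x₊ - x) ≡ p * (x + p₊ * x₊) - ((p * x - x₊) + p * x)
      expand = solve-∀

    backwardSum-solution : Solution (backwardSum f)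
    backwardSum-solution i
      rewrite i+1-1≡i i | f-sol i | r--2≡r i | solution-backward f-sol (i - + 1) | i-1+1≡i i =
        expand (f i) (f (i - + 1)) (r b c i) (r b c (i - + 1))
      where
      expand : ∀ x x₋ p p₋ → (p * x - x₋) + p * x ≡ p * (x + p₋ * x₋) - (x₋ + p * (p₋ * x₋ - x))
      expand = solve-∀

    forwardSum-at-pred-pred : ∀ i → + 2 * f (i - + 2) + f i ≡ forwardSum f (i - + 2)
    forwardSum-at-pred-pred i rewrite i-2≡i-1-1 i = begin
      + 2 * f (j - + 1) + f i                        ≡⟨ cong (λ x → + 2 * f (j - + 1) + x) f[i] ⟩
      + 2 * f (j - + 1) + (r b c j * f j - f (j - + 1)) ≡⟨ regroup (f (j - + 1)) (r b c j * f j) ⟩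
      f (j - + 1) + r b c j * f j                    ≡⟨ forwardSum-at-pred f j ⟩
      forwardSum f (j - + 1)                         ∎
      where
      open ≡-Reasoning
      j : ℤ
      j = i - + 1
      f[i] : f i ≡ r b c j * f j - f (j - + 1)
      f[i] = trans (cong f (sym (i-1+1≡i i))) (f-sol j)
      regroup : ∀ x y → + 2 * x + (y - x) ≡ x + y
      regroup = solve-∀

    backwardSum-at-suc : ∀ i → + 2 * r b c i * f i - f (i - + 1) ≡ backwardSum f (i + + 1)
    backwardSum-at-suc i rewrite i+1-1≡i i | f-sol i = regroup (r b c i) (f i) (f (i - + 1))
      where
      regroup : ∀ p x x₋ → + 2 * p * x - x₋ ≡ (p * x - x₋) + p * x
      regroup = solve-∀

    quadraticForm-neighbours : ∀ i → r b c (i - + 1) * f (i - + 1) * f (i + + 1) - r b c i * (f i * f i)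
                                   ≡ quadraticForm f i
    quadraticForm-neighbours i rewrite f-sol i | sym (r-1*r≡b*c i) =
      expand (f (i - + 1)) (f i) (r b c (i - + 1)) (r b c i)
      where
      expand : ∀ x₋ x p₋ p → p₋ * x₋ * (p * x - x₋) - p * (x * x)
                           ≡ p₋ * p * x₋ * x - p₋ * (x₋ * x₋) - p * (x * x)
      expand = solve-∀

    casoratian-forwardSum : ∀ i → casoratian f (forwardSum f) i ≡ quadraticForm f i
    casoratian-forwardSum i rewrite i-1+1≡i i | r-+1≡r-1 i =
      trans (expand (f (i - + 1)) (f i) (f (i + + 1)) (r b c (i - + 1)) (r b c i))
            (quadraticForm-neighbours i)
      where
      expand : ∀ x₋ x x₊ p₋ p → x₋ * (x + p₋ * x₊) - x * (x₋ + p * x) ≡ p₋ * x₋ * x₊ - p * (x * x)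
      expand = solve-∀

    casoratian-backwardSum : ∀ i → casoratian (backwardSum f) f i ≡ quadraticForm f i
    casoratian-backwardSum i
      rewrite r--2≡r i | solution-backward f-sol (i - + 1) | i-1+1≡i i | sym (r-1*r≡b*c i) =
        expand (f (i - + 1)) (f i) (r b c (i - + 1)) (r b c i)
      where
      expand : ∀ x₋ x p₋ p → (x₋ + p * (p₋ * x₋ - x)) * x - (x + p₋ * x₋) * x₋
                           ≡ p₋ * p * x₋ * x - p₋ * (x₋ * x₋) - p * (x * x)
      expand = solve-∀

    quadraticForm-constant : ∀ i → quadraticForm f i ≡ quadraticForm f (+ 0)
    quadraticForm-constant i = begin
      quadraticForm f i                   ≡⟨ sym (casoratian-forwardSum i) ⟩
      casoratian f (forwardSum f) i       ≡⟨ casoratian-constant f-sol forwardSum-solution i ⟩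
      casoratian f (forwardSum f) (+ 0)   ≡⟨ casoratian-forwardSum (+ 0) ⟩
      quadraticForm f (+ 0)               ∎
      where open ≡-Reasoning

    0<quadraticForm⇒0<f : + 0 < quadraticForm f (+ 0) → + 0 < f (+ 0) → ∀ n → + 0 < f (+ n)
    0<quadraticForm⇒0<f 0<Q 0<f₀ zero    = 0<f₀
    0<quadraticForm⇒0<f 0<Q 0<f₀ (suc n) =
      0<quadratic⇒0<z (0≤*0≤ {+ b} {+ c} (+≤+ z≤n) (+≤+ z≤n)) (0≤r (+ n)) (0≤r (+ suc n))
                      (ℤ.<⇒≤ (0<quadraticForm⇒0<f 0<Q 0<f₀ n))
                      (subst (+ 0 <_) (sym (quadraticForm-constant (+ suc n))) 0<Q)

  f<forwardSum : 1 ≤ b → 1 ≤ c → ∀ {f} → (∀ n → + 0 < f (+ n)) → ∀ n → f (+ n) < forwardSum f (+ n)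
  f<forwardSum 1≤b 1≤c {f} 0<f n =
    subst (_< forwardSum f (+ n)) (ℤ.+-identityʳ (f (+ n)))
          (ℤ.+-monoʳ-< (f (+ n)) (0<*0< (0<r 1≤b 1≤c (+ n + + 1)) (0<f (n +ℕ 1))))

  Relations : (f g h : ℤ → ℤ) → ℤ → ℤ → Set
  Relations f g h d k =
      (+ 2 * f (k - + 2) + f k ≡ g (k - + 2))
    × (f (k - + 1) + r b c k * f k ≡ g (k - + 1))
    × (+ 2 * r b c k * f k - f (k - + 1) ≡ h (k + + 1))
    × (backwardSum f k ≡ h k)
    × (casoratian f g k ≡ d)
    × (f k * h (k - + 1) - f (k - + 1) * h k ≡ d)
    × (r b c (k - + 1) * f (k - + 1) * f (k + + 1) - r b c k * (f k * f k) ≡ d)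
    × (quadraticForm f k ≡ d)

  relations : ∀ {f g h d} → Solution f →
              (∀ i → g i ≡ forwardSum f i) → (∀ i → h i ≡ backwardSum f i) →
              quadraticForm f (+ 0) ≡ d → ∀ k → Relations f g h d k
  relations {f} {g} {h} {d} f-sol g≗ h≗ Q₀≡d k =
      trans (forwardSum-at-pred-pred f-sol k) (sym (g≗ (k - + 2)))
    , trans (forwardSum-at-pred f k) (sym (g≗ (k - + 1)))
    , trans (backwardSum-at-suc f-sol k) (sym (h≗ (k + + 1)))
    , sym (h≗ k)
    , trans (cong₂ (λ u v → f (k - + 1) * u - f k * v) (g≗ k) (g≗ (k - + 1)))
            (trans (casoratian-forwardSum f-sol k) Q≡d)
    , trans (cong₂ (λ u v → f k * u - f (k - + 1) * v) (h≗ (k - + 1)) (h≗ k))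
            (trans (cong₂ _-_ (ℤ.*-comm (f k) _) (ℤ.*-comm (f (k - + 1)) _))
                   (trans (casoratian-backwardSum f-sol k) Q≡d))
    , trans (quadraticForm-neighbours f-sol k) Q≡d
    , Q≡d
    where
    Q≡d : quadraticForm f k ≡ d
    Q≡d = trans (quadraticForm-constant f-sol k) Q₀≡d

InitialValues : ℕ → ℕ → Set
InitialValues b c =
    (β b c (+ 0) ≡ forwardSum b c (α b c) (+ 0))
  × (β b c -[1+ 0 ] ≡ forwardSum b c (α b c) -[1+ 0 ])
  × (γ b c (+ 0) ≡ backwardSum b c (α b c) (+ 0))
  × (γ b c -[1+ 0 ] ≡ backwardSum b c (α b c) -[1+ 0 ])
  × (quadraticForm b c (α b c) (+ 0) ≡ δ b c)

-- InitialValues b c unfolds to these identities for the two shapes of initial data in Defs;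
-- c = 0 falls under the generic shape.
initialValues-c≢1 : ∀ B C →
    ((C - + 1) * B + + 1 ≡ + 1 + B * (C * + 1 - + 1))
  × (C + + 1 ≡ + 1 + C * + 1)
  × (B + + 1 ≡ + 1 + B * + 1)
  × ((B - + 1) * C + + 1 ≡ + 1 + C * (B * + 1 - + 1))
  × (B * C * + 1 * + 1 - B * (+ 1 * + 1) - C * (+ 1 * + 1) ≡ B * C - B - C)
initialValues-c≢1 B C =
  solve (B ∷ C ∷ []) , solve (C ∷ []) , solve (B ∷ []) , solve (B ∷ C ∷ []) , solve (B ∷ C ∷ [])

initialValues-c≡1 : ∀ B →
    (B + + 2 ≡ + 2 + B * (+ 1 * + 2 - + 1))
  × (+ 3 ≡ + 1 + + 1 * + 2)
  × (B + + 2 ≡ + 2 + B * + 1)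
  × (B - + 1 ≡ + 1 + + 1 * (B * + 1 - + 2))
  × (B * + 1 * + 1 * + 2 - B * (+ 1 * + 1) - + 1 * (+ 2 * + 2) ≡ B - + 4)
initialValues-c≡1 B = solve (B ∷ []) , refl , solve (B ∷ []) , solve (B ∷ []) , solve (B ∷ [])

initialValues : ∀ b c → InitialValues b c
initialValues b zero          = initialValues-c≢1 (+ b) (+ 0)
initialValues b (suc zero)    = initialValues-c≡1 (+ b)
initialValues b (suc (suc c)) = initialValues-c≢1 (+ b) (+ suc (suc c))

0<α₀ : ∀ b c → + 0 < α b c (+ 0)
0<α₀ b zero          = +<+ (s≤s z≤n)
0<α₀ b (suc zero)    = +<+ (s≤s z≤n)
0<α₀ b (suc (suc c)) = +<+ (s≤s z≤n)

δ-positive : ∀ b c → c ≤ b → 1 ≤ c → 4 <ℕ b *ℕ c → + 0 < δ b c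
δ-positive b zero _ () _
δ-positive b (suc zero) _ _ 4<b*1 = 4<b⇒0<b-4 (subst (4 <ℕ_) (ℕ.*-identityʳ b) 4<b*1)
  where
  4<b⇒0<b-4 : ∀ {b} → 4 <ℕ b → + 0 < + b - + 4
  4<b⇒0<b-4 (s≤s (s≤s (s≤s (s≤s (s≤s _))))) = +<+ (s≤s z≤n)
δ-positive (suc (suc (suc b))) (suc (suc c)) _ _ _ =
  subst (+ 0 <_) (sym (expand (+ b) (+ c)))
        (subst (+ 0 <_) (cong₂ (λ u v → + 1 + + b + u + v) (ℤ.pos-* 2 c) (ℤ.pos-* b c)) (+<+ (s≤s z≤n)))
  where
  expand : ∀ x y → (+ 3 + x) * (+ 2 + y) - (+ 3 + x) - (+ 2 + y) ≡ + 1 + x + + 2 * y + x * y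
  expand = solve-∀
δ-positive (suc (suc zero)) (suc (suc zero)) _ _ (s≤s (s≤s (s≤s (s≤s ()))))
δ-positive (suc (suc zero)) (suc (suc (suc c))) (s≤s (s≤s ())) _ _
δ-positive (suc zero) (suc (suc c)) (s≤s ()) _ _
δ-positive zero (suc (suc c)) () _ _

lemma4p6 : (b c : ℕ) → c ≤ b → 1 ≤ c → 4 <ℕ b *ℕ c →
    ((n : ℕ) → α b c (+ n) < β b c (+ n))
    × ((k : ℤ) →
        (+ 2 * α b c (k - + 2) + α b c k ≡ β b c (k - + 2))
        × (α b c (k - + 1) + r b c k * α b c k ≡ β b c (k - + 1))
        × (+ 2 * r b c k * α b c k - α b c (k - + 1) ≡ γ b c (k + + 1))
        × (α b c k + r b c (k - + 1) * α b c (k - + 1) ≡ γ b c k)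
        × (α b c (k - + 1) * β b c k - α b c k * β b c (k - + 1) ≡ δ b c)
        × (α b c k * γ b c (k - + 1) - α b c (k - + 1) * γ b c k ≡ δ b c)
        × (r b c (k - + 1) * α b c (k - + 1) * α b c (k + + 1)
             - r b c k * (α b c k * α b c k) ≡ δ b c)
        × (+ b * + c * α b c (k - + 1) * α b c k
             - r b c (k - + 1) * (α b c (k - + 1) * α b c (k - + 1))
             - r b c k * (α b c k * α b c k) ≡ δ b c))
    × (+ 0 < δ b c)
lemma4p6 b c c≤b 1≤c 4<bc with initialValues b c
... | β₀ , β₋₁ , γ₀ , γ₋₁ , Q₀≡δ =
    (λ n → subst (α b c (+ n) <_) (sym (β≗ (+ n))) (f<forwardSum b c 1≤b 1≤c {α b c} 0<α n))
  , relations b c α-solution β≗ γ≗ Q₀≡δ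
  , 0<δ
  where
  open LinearRecurrence (r b c)
  1≤b : 1 ≤ b
  1≤b = ℕ.≤-trans 1≤c c≤b
  0<δ : + 0 < δ b c
  0<δ = δ-positive b c c≤b 1≤c 4<bc
  α-solution : Solution (α b c)
  α-solution = seq-solution b c _ _
  β≗ : ∀ i → β b c i ≡ forwardSum b c (α b c) i
  β≗ = solutions-equal (seq-solution b c _ _) (forwardSum-solution b c α-solution) β₀ β₋₁
  γ≗ : ∀ i → γ b c i ≡ backwardSum b c (α b c) i
  γ≗ = solutions-equal (seq-solution b c _ _) (backwardSum-solution b c α-solution) γ₀ γ₋₁
  0<α : ∀ n → + 0 < α b c (+ n)
  0<α = 0<quadraticForm⇒0<f b c α-solution (subst (+ 0 <_) (sym Q₀≡δ) 0<δ) (0<α₀ b c)
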